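{- If $G$ is a partial cube, then $c(G) \geq \left\lceil \frac{\delta(G)}{2} \right\rceil$, where $c(G)$ is the cop number of $G$ and $\delta(G)$ is the minimum degree of $G$.
   Context: The $n$-dimensional hypercube $Q_n$ has vertex set $\{0,1\}^n$, two strings adjacent iff they differ in exactly one position. An induced subgraph $H$ of a graph $G'$ is isometric if $d_H(u,v)=d_{G'}(u,v)$ for all $u,v\in V(H)$. A partial cube is a connected isometric subgraph of a hypercube. Cops and Robbers on a finite simple undirected graph $G$ with $k$ cops: first the $k$ cops choose starting vertices, then the robber chooses a starting vertex; then rounds alternate, in each round all cops move and then the robber moves, where each player either moves to a neighboring vertex or stays in place. The cops win if at some point a cop occupies the same vertex as the robber; the robber wins if he evades capture forever. The cop number $c(G)$ is the minimum $k$ such that $k$ cops have a strategy guaranteeing capture. -}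

module Defs where

open import Data.Nat using (ℕ; zero; suc; _+_; _≤_; _⊓_)
open import Data.Bool using (Bool; true; false; if_then_else_)
open import Data.Fin using (Fin)
open import Data.Vec using (Vec; []; _∷_)
open import Data.Vec.Relation.Unary.Any using (Any)
open import Data.Vec.Relation.Binary.Pointwise.Inductive using (Pointwise)
open import Data.Product using (Σ; _×_)
open import Data.Sum using (_⊎_)
open import Relation.Binary.PropositionalEquality using (_≡_)
open import Relation.Nullary using (¬_)
open import Relation.Nullary.Decidable using (⌊_⌋)
open import Data.Bool.Properties using () renaming (_≟_ to _≟B_)
open import Function using (_∘_)

record Graph : Set where
  field
    n     : ℕ
    adj   : Fin n → Fin n → Bool
    sym   : ∀ u v → adj u v ≡ adj v u
    irrefl : ∀ v → adj v v ≡ false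
open Graph public

countTrue : (m : ℕ) → (Fin m → Bool) → ℕ
countTrue zero f = 0
countTrue (suc m) f = (if f Fin.zero then 1 else 0) + countTrue m (f ∘ Fin.suc)

degree : (G : Graph) → Fin (n G) → ℕ
degree G v = countTrue (n G) (adj G v)

-- Minimum of a function on Fin m (value 0 for the empty set; only used for m ≥ 1).
minOver : (m : ℕ) → (Fin m → ℕ) → ℕ
minOver zero f = 0
minOver (suc zero) f = f Fin.zero
minOver (suc (suc m)) f = f Fin.zero ⊓ minOver (suc m) (f ∘ Fin.suc)

minDegree : Graph → ℕ
minDegree G = minOver (n G) (degree G)

data Walk (G : Graph) : Fin (n G) → Fin (n G) → ℕ → Set where
  here : ∀ {u} → Walk G u u 0
  step : ∀ {u w v l} → adj G u w ≡ true → Walk G w v l → Walk G u v (suc l)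

IsDist : (G : Graph) → Fin (n G) → Fin (n G) → ℕ → Set
IsDist G u v d = Walk G u v d × (∀ l → Walk G u v l → d ≤ l)

Connected : Graph → Set
Connected G = ∀ u v → Σ ℕ (Walk G u v)

hamming : ∀ {k} → Vec Bool k → Vec Bool k → ℕ
hamming [] [] = 0
hamming (x ∷ xs) (y ∷ ys) = (if ⌊ x ≟B y ⌋ then 0 else 1) + hamming xs ys

-- G is (isomorphic to) a connected, induced, isometric subgraph of Q_k.
IsPartialCube : Graph → Set
IsPartialCube G =
  Connected G ×
  Σ ℕ λ k → Σ (Fin (n G) → Vec Bool k) λ f →
    (∀ u v → f u ≡ f v → u ≡ v) ×
    (∀ u v → adj G u v ≡ true → hamming (f u) (f v) ≡ 1) ×
    (∀ u v → hamming (f u) (f v) ≡ 1 → adj G u v ≡ true) ×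
    (∀ u v → IsDist G u v (hamming (f u) (f v)))

Step : (G : Graph) → Fin (n G) → Fin (n G) → Set
Step G u v = u ≡ v ⊎ adj G u v ≡ true

Caught : (G : Graph) → ∀ {k} → Vec (Fin (n G)) k → Fin (n G) → Set
Caught G C r = Any (r ≡_) C

-- CopWin G C r : cops at C, robber at r, cops to move; the cops can force capture.
-- (Inductive = capture in finitely many rounds against every robber play.)
data CopWin (G : Graph) {k : ℕ} (C : Vec (Fin (n G)) k) (r : Fin (n G)) : Set where
  move : (C' : Vec (Fin (n G)) k) → Pointwise (Step G) C C' →
         (Caught G C' r ⊎ (∀ r' → Step G r r' → Caught G C' r' ⊎ CopWin G C' r')) →
         CopWin G C r

CopsWin : Graph → ℕ → Set
CopsWin G k = Σ (Vec (Fin (n G)) k) λ C₀ → ∀ r₀ → Caught G C₀ r₀ ⊎ CopWin G C₀ r₀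

{-# OPTIONS --safe #-}
module Submission where

-- A cop at c ≠ r can reach at most two neighbours of the robber's vertex r in one
-- move.  If c ~ r it reaches only c itself, because a subgraph of a hypercube is
-- bipartite (parity of the number of ones) and so triangle-free; otherwise it reaches
-- only common neighbours of c and r, and two distinct vertices of a hypercube have at
-- most two common neighbours.  So when every degree exceeds 2k, k cops always leave
-- the robber a neighbour that no cop can reach next move; he starts on such a vertex
-- and keeps moving to one.  Only the embedding of G as a (not necessarily induced or
-- isometric) subgraph of a hypercube is used.

open import Defs hiding (sym)
open import Data.Nat using (ℕ; zero; suc; _+_; _*_; _≤_; _<_; ⌈_/2⌉; z≤n; s≤s; _≤?_)
open import Data.Nat.Properties
  using (≤-refl; ≤-trans; ≤-reflexive; m≤n⇒m≤1+n; +-suc; +-comm; +-identityʳ; *-comm;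
         +-cancelˡ-≤; +-monoʳ-≤; ≰⇒>; ≮⇒≥; m⊓n≤m; m⊓n≤n; suc-injective;
         ⌈n/2⌉-mono; n≡⌈n+n/2⌉; module ≤-Reasoning)
open import Data.Bool using (Bool; true; false; not; _∧_; _xor_)
open import Data.Bool.Properties
  using (∧-conicalˡ; ∧-conicalʳ; not-involutive; not-¬) renaming (_≟_ to _≟B_)
open import Data.Fin using (Fin; fromℕ<; _≟_) renaming (zero to fz; suc to fs)
import Data.Fin.Properties as Fin
open import Data.Vec using (Vec; []; _∷_)
open import Data.Vec.Relation.Unary.All using (All; []; _∷_)
import Data.Vec.Relation.Unary.All as All
open import Data.Vec.Relation.Binary.Pointwise.Inductive using (Pointwise; []; _∷_)
import Data.Vec.Relation.Binary.Pointwise.Inductive as Pointwise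
open import Data.Product using (∃; _×_; _,_; proj₁; proj₂)
open import Data.Sum using (_⊎_; inj₁; inj₂; [_,_])
import Data.Sum as Sum
open import Relation.Binary.PropositionalEquality
  using (_≡_; _≢_; refl; sym; trans; cong; cong₂)
open import Relation.Nullary using (¬_; Dec; does; yes; no; contradiction)
open import Relation.Nullary.Decidable using (_⊎-dec_; dec-true)
open import Function using (_∘_; _$_; id)

does≡true⇒ : ∀ {A : Set} (a? : Dec A) → does a? ≡ true → A
does≡true⇒ (yes a) _ = a

does≡false⇒¬ : ∀ {A : Set} (a? : Dec A) → does a? ≡ false → ¬ A
does≡false⇒¬ a? d a = contradiction (trans (sym (dec-true a? a)) d) λ ()

countTrue-mono : ∀ {m} {g h : Fin m → Bool} →
  (∀ u → g u ≡ true → h u ≡ true) → countTrue m g ≤ countTrue m h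
countTrue-mono {zero} g⇒h = z≤n
countTrue-mono {suc m} {g} {h} g⇒h with g fz in g₀ | h fz in h₀
... | true  | true  = s≤s (countTrue-mono (g⇒h ∘ fs))
... | true  | false = contradiction (trans (sym (g⇒h fz g₀)) h₀) λ ()
... | false | true  = m≤n⇒m≤1+n (countTrue-mono (g⇒h ∘ fs))
... | false | false = countTrue-mono (g⇒h ∘ fs)

countTrue-split : ∀ {m} (g h : Fin m → Bool) →
  countTrue m g ≡ countTrue m (λ u → g u ∧ not (h u)) + countTrue m (λ u → g u ∧ h u)
countTrue-split {zero} g h = refl
countTrue-split {suc m} g h with g fz | h fz | countTrue-split (g ∘ fs) (h ∘ fs)
... | true  | true  | split = trans (cong suc split) (sym (+-suc _ _))
... | true  | false | split = cong suc split
... | false | _     | split = split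

countTrue-witness : ∀ {m} {g : Fin m → Bool} → 0 < countTrue m g → ∃ λ u → g u ≡ true
countTrue-witness {suc m} {g} pos with g fz in g₀
... | true  = fz , g₀
... | false = let u , gu = countTrue-witness pos in fs u , gu

countTrue-≤1 : ∀ {m} {g : Fin m → Bool} →
  (∀ u v → g u ≡ true → g v ≡ true → u ≡ v) → countTrue m g ≤ 1
countTrue-≤1 {zero} unique = z≤n
countTrue-≤1 {suc m} {g} unique with g fz in g₀
... | true  = s≤s (≮⇒≥ λ pos → let u , gu = countTrue-witness pos in
                                 contradiction (unique fz (fs u) g₀ gu) λ ())
... | false = countTrue-≤1 λ u v gu gv → Fin.suc-injective (unique (fs u) (fs v) gu gv)

countTrue-≤2 : ∀ {m} {g : Fin m → Bool} →
  (∀ u v w → g u ≡ true → g v ≡ true → g w ≡ true → u ≡ v ⊎ u ≡ w ⊎ v ≡ w) →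
  countTrue m g ≤ 2
countTrue-≤2 {zero} twoOf3 = z≤n
countTrue-≤2 {suc m} {g} twoOf3 with g fz in g₀
... | true  = s≤s (countTrue-≤1 λ u v gu gv →
                Fin.suc-injective ([ (λ ()) , [ (λ ()) , id ] ] (twoOf3 fz (fs u) (fs v) g₀ gu gv)))
... | false = countTrue-≤2 λ u v w gu gv gw →
                Sum.map Fin.suc-injective (Sum.map Fin.suc-injective Fin.suc-injective)
                  (twoOf3 (fs u) (fs v) (fs w) gu gv gw)

unblocked : ∀ {X : Set} {m k b} (blocks : X → Fin m → Bool) (g : Fin m → Bool) (C : Vec X k) →
  All (λ c → countTrue m (λ u → g u ∧ blocks c u) ≤ b) C → k * b < countTrue m g →
  ∃ λ u → g u ≡ true × All (λ c → blocks c u ≡ false) C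
unblocked blocks g [] [] pos = let u , gu = countTrue-witness pos in u , gu , []
unblocked {m = m} {suc k} {b} blocks g (c ∷ C) (c-blocks≤b ∷ C-blocks≤b) more =
  let u , g′u , free = unblocked blocks g′ C (All.map restrict C-blocks≤b) fewer
  in u , ∧-conicalˡ _ _ g′u , trans (sym (not-involutive _)) (cong not (∧-conicalʳ _ _ g′u)) ∷ free
  where
  g′ : Fin m → Bool
  g′ u = g u ∧ not (blocks c u)

  restrict : ∀ {d} → countTrue m (λ u → g u ∧ blocks d u) ≤ b →
    countTrue m (λ u → g′ u ∧ blocks d u) ≤ b
  restrict {d} = ≤-trans (countTrue-mono λ u e →
    cong₂ _∧_ (∧-conicalˡ (g u) _ (∧-conicalˡ (g′ u) (blocks d u) e)) (∧-conicalʳ (g′ u) _ e))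

  fewer : k * b < countTrue m g′
  fewer = +-cancelˡ-≤ b _ _ $ begin
    b + suc (k * b)                                        ≡⟨ +-suc b (k * b) ⟩
    suc (b + k * b)                                        ≤⟨ more ⟩
    countTrue m g                                          ≡⟨ countTrue-split g (blocks c) ⟩
    countTrue m g′ + countTrue m (λ u → g u ∧ blocks c u)  ≤⟨ +-monoʳ-≤ _ c-blocks≤b ⟩
    countTrue m g′ + b                                     ≡⟨ +-comm _ b ⟩
    b + countTrue m g′                                     ∎
    where open ≤-Reasoning

minOver-≤ : ∀ m (f : Fin m → ℕ) i → minOver m f ≤ f i
minOver-≤ (suc zero)    f fz     = ≤-refl
minOver-≤ (suc (suc m)) f fz     = m⊓n≤m _ _
minOver-≤ (suc (suc m)) f (fs i) = ≤-trans (m⊓n≤n _ _) (minOver-≤ (suc m) (f ∘ fs) i)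

parity : ∀ {K} → Vec Bool K → Bool
parity []       = false
parity (x ∷ xs) = x xor parity xs

hamming≡0⇒≡ : ∀ {K} (x y : Vec Bool K) → hamming x y ≡ 0 → x ≡ y
hamming≡0⇒≡ []         []         _ = refl
hamming≡0⇒≡ (true ∷ x)  (true ∷ y)  d = cong (true ∷_) (hamming≡0⇒≡ x y d)
hamming≡0⇒≡ (false ∷ x) (false ∷ y) d = cong (false ∷_) (hamming≡0⇒≡ x y d)

hamming≡1⇒parity-flips : ∀ {K} (x y : Vec Bool K) → hamming x y ≡ 1 → parity y ≡ not (parity x)
hamming≡1⇒parity-flips []          []          ()
hamming≡1⇒parity-flips (true ∷ x)  (true ∷ y)  d = cong not (hamming≡1⇒parity-flips x y d)
hamming≡1⇒parity-flips (false ∷ x) (false ∷ y) d = hamming≡1⇒parity-flips x y d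
hamming≡1⇒parity-flips (true ∷ x)  (false ∷ y) d =
  trans (cong parity (sym (hamming≡0⇒≡ x y (suc-injective d)))) (sym (not-involutive _))
hamming≡1⇒parity-flips (false ∷ x) (true ∷ y)  d =
  cong (not ∘ parity) (sym (hamming≡0⇒≡ x y (suc-injective d)))

hypercube-triangle-free : ∀ {K} (x y z : Vec Bool K) →
  hamming x y ≡ 1 → hamming y z ≡ 1 → hamming x z ≢ 1
hypercube-triangle-free x y z x~y y~z x~z = not-¬ pz≡px (hamming≡1⇒parity-flips x z x~z)
  where
  pz≡px : parity z ≡ parity x
  pz≡px = trans (hamming≡1⇒parity-flips y z y~z)
                (trans (cong not (hamming≡1⇒parity-flips x y x~y)) (not-involutive _))

midpoints : ∀ {K} → Vec Bool K → Vec Bool K → Vec Bool K × Vec Bool K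
midpoints []          []          = [] , []
midpoints (true ∷ a)  (true ∷ b)  = let p , q = midpoints a b in true ∷ p , true ∷ q
midpoints (false ∷ a) (false ∷ b) = let p , q = midpoints a b in false ∷ p , false ∷ q
midpoints (true ∷ a)  (false ∷ b) = true ∷ b , false ∷ a
midpoints (false ∷ a) (true ∷ b)  = false ∷ b , true ∷ a

commonNeighbour⇒midpoint : ∀ {K} (a b u : Vec Bool K) → a ≢ b →
  hamming a u ≡ 1 → hamming u b ≡ 1 → u ≡ proj₁ (midpoints a b) ⊎ u ≡ proj₂ (midpoints a b)
commonNeighbour⇒midpoint [] [] [] _ () _
commonNeighbour⇒midpoint (true ∷ a) (true ∷ b) (true ∷ u) a≢b a~u u~b =
  Sum.map (cong (true ∷_)) (cong (true ∷_))
    (commonNeighbour⇒midpoint a b u (a≢b ∘ cong (true ∷_)) a~u u~b)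
commonNeighbour⇒midpoint (false ∷ a) (false ∷ b) (false ∷ u) a≢b a~u u~b =
  Sum.map (cong (false ∷_)) (cong (false ∷_))
    (commonNeighbour⇒midpoint a b u (a≢b ∘ cong (false ∷_)) a~u u~b)
commonNeighbour⇒midpoint (true ∷ a) (true ∷ b) (false ∷ u) a≢b a~u u~b =
  contradiction (cong (true ∷_) (trans (hamming≡0⇒≡ a u (suc-injective a~u))
                                       (hamming≡0⇒≡ u b (suc-injective u~b)))) a≢b
commonNeighbour⇒midpoint (false ∷ a) (false ∷ b) (true ∷ u) a≢b a~u u~b =
  contradiction (cong (false ∷_) (trans (hamming≡0⇒≡ a u (suc-injective a~u))
                                        (hamming≡0⇒≡ u b (suc-injective u~b)))) a≢b
commonNeighbour⇒midpoint (true ∷ a) (false ∷ b) (true ∷ u) _ _ u~b =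
  inj₁ (cong (true ∷_) (hamming≡0⇒≡ u b (suc-injective u~b)))
commonNeighbour⇒midpoint (true ∷ a) (false ∷ b) (false ∷ u) _ a~u _ =
  inj₂ (cong (false ∷_) (sym (hamming≡0⇒≡ a u (suc-injective a~u))))
commonNeighbour⇒midpoint (false ∷ a) (true ∷ b) (false ∷ u) _ _ u~b =
  inj₁ (cong (false ∷_) (hamming≡0⇒≡ u b (suc-injective u~b)))
commonNeighbour⇒midpoint (false ∷ a) (true ∷ b) (true ∷ u) _ a~u _ =
  inj₂ (cong (true ∷_) (sym (hamming≡0⇒≡ a u (suc-injective a~u))))

pigeonhole₃ : ∀ {A : Set} {p q u v w : A} →
  u ≡ p ⊎ u ≡ q → v ≡ p ⊎ v ≡ q → w ≡ p ⊎ w ≡ q → u ≡ v ⊎ u ≡ w ⊎ v ≡ w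
pigeonhole₃ (inj₁ refl) (inj₁ refl) _           = inj₁ refl
pigeonhole₃ (inj₂ refl) (inj₂ refl) _           = inj₁ refl
pigeonhole₃ (inj₁ refl) (inj₂ refl) (inj₁ refl) = inj₂ (inj₁ refl)
pigeonhole₃ (inj₂ refl) (inj₁ refl) (inj₂ refl) = inj₂ (inj₁ refl)
pigeonhole₃ (inj₁ refl) (inj₂ refl) (inj₂ refl) = inj₂ (inj₂ refl)
pigeonhole₃ (inj₂ refl) (inj₁ refl) (inj₁ refl) = inj₂ (inj₂ refl)

TriangleFree : Graph → Set
TriangleFree G = ∀ {u v w} → adj G u v ≡ true → adj G v w ≡ true → adj G u w ≢ true

CommonNeighbour : (G : Graph) → Fin (n G) → Fin (n G) → Fin (n G) → Set
CommonNeighbour G a b u = adj G a u ≡ true × adj G u b ≡ true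

K₂₃-Free : Graph → Set
K₂₃-Free G = ∀ {a b} → a ≢ b → ∀ u v w →
  CommonNeighbour G a b u → CommonNeighbour G a b v → CommonNeighbour G a b w →
  u ≡ v ⊎ u ≡ w ⊎ v ≡ w

IsCubeSubgraph : Graph → Set
IsCubeSubgraph G =
  ∃ λ K → ∃ λ (f : Fin (n G) → Vec Bool K) →
    (∀ u v → f u ≡ f v → u ≡ v) × (∀ u v → adj G u v ≡ true → hamming (f u) (f v) ≡ 1)

partialCube⇒cubeSubgraph : ∀ {G} → IsPartialCube G → IsCubeSubgraph G
partialCube⇒cubeSubgraph (_ , K , f , injective , edge⇒hamming≡1 , _) =
  K , f , injective , edge⇒hamming≡1

cubeSubgraph⇒triangleFree : ∀ {G} → IsCubeSubgraph G → TriangleFree G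
cubeSubgraph⇒triangleFree (_ , f , _ , edge) {u} {v} {w} u~v v~w u~w =
  hypercube-triangle-free (f u) (f v) (f w) (edge u v u~v) (edge v w v~w) (edge u w u~w)

cubeSubgraph⇒K₂₃-free : ∀ {G} → IsCubeSubgraph G → K₂₃-Free G
cubeSubgraph⇒K₂₃-free (_ , f , injective , edge) {a} {b} a≢b u v w u∈ab v∈ab w∈ab =
  Sum.map (injective u v) (Sum.map (injective u w) (injective v w))
    (pigeonhole₃ (midpoint u u∈ab) (midpoint v v∈ab) (midpoint w w∈ab))
  where
  midpoint : ∀ x → _ → f x ≡ proj₁ (midpoints (f a) (f b)) ⊎ f x ≡ proj₂ (midpoints (f a) (f b))
  midpoint x (a~x , x~b) =
    commonNeighbour⇒midpoint (f a) (f b) (f x) (a≢b ∘ injective a b) (edge a x a~x) (edge x b x~b)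

step? : (G : Graph) → ∀ c u → Dec (Step G c u)
step? G c u = (c ≟ u) ⊎-dec (adj G c u ≟B true)

guards : (G : Graph) → Fin (n G) → Fin (n G) → Bool
guards G c u = does (step? G c u)

BoundedGuarding : Graph → ℕ → Set
BoundedGuarding G b = ∀ {r c} → r ≢ c → countTrue (n G) (λ u → adj G r u ∧ guards G c u) ≤ b

triangleFree⇒K₂₃-free⇒boundedGuarding : ∀ {G} → TriangleFree G → K₂₃-Free G → BoundedGuarding G 2
triangleFree⇒K₂₃-free⇒boundedGuarding {G} triangleFree k₂₃Free {r} {c} r≢c with adj G r c in r~c
... | true  = ≤-trans (countTrue-≤1 λ u v u∈ v∈ → trans (only-c u u∈) (sym (only-c v v∈))) (s≤s z≤n)
  where
  only-c : ∀ u → adj G r u ∧ guards G c u ≡ true → u ≡ c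
  only-c u guarded with does≡true⇒ (step? G c u) (∧-conicalʳ (adj G r u) _ guarded)
  ... | inj₁ c≡u = sym c≡u
  ... | inj₂ c~u = contradiction r~c
                     (triangleFree (∧-conicalˡ _ _ guarded) (trans (Graph.sym G u c) c~u))
... | false = countTrue-≤2 λ u v w u∈ v∈ w∈ →
                k₂₃Free r≢c u v w (common u u∈) (common v v∈) (common w w∈)
  where
  common : ∀ u → adj G r u ∧ guards G c u ≡ true → CommonNeighbour G r c u
  common u guarded with does≡true⇒ (step? G c u) (∧-conicalʳ (adj G r u) _ guarded)
  ... | inj₁ refl = contradiction (trans (sym r~c) (∧-conicalˡ _ _ guarded)) λ ()
  ... | inj₂ c~u = ∧-conicalˡ _ _ guarded , trans (Graph.sym G u c) c~u

cubeSubgraph⇒boundedGuarding : ∀ {G} → IsCubeSubgraph G → BoundedGuarding G 2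
cubeSubgraph⇒boundedGuarding {G} cube = triangleFree⇒K₂₃-free⇒boundedGuarding {G}
  (cubeSubgraph⇒triangleFree {G} cube) (cubeSubgraph⇒K₂₃-free {G} cube)

module Evasion (G : Graph) {b k : ℕ} (guarding : BoundedGuarding G b) (1≤b : 1 ≤ b)
               (degree> : ∀ v → k * b < degree G v) where

  Vertex : Set
  Vertex = Fin (n G)

  Safe : ∀ {m} → Vec Vertex m → Vertex → Set
  Safe C r = All (λ c → ¬ Step G c r) C

  unoccupied-after-move : ∀ {m} {C C′ : Vec Vertex m} {r} → Pointwise (Step G) C C′ → Safe C r → All (r ≢_) C′
  unoccupied-after-move []                []              = []
  unoccupied-after-move (c⟶c′ ∷ moves) (c↛r ∷ safe) =
    (λ { refl → c↛r c⟶c′ }) ∷ unoccupied-after-move moves safe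

  safe⇒unoccupied : ∀ {m} {C : Vec Vertex m} {r} → Safe C r → All (r ≢_) C
  safe⇒unoccupied = unoccupied-after-move (Pointwise.refl (inj₁ refl))

  unoccupied⇒¬caught : ∀ {m} {C : Vec Vertex m} {r} → All (r ≢_) C → ¬ Caught G C r
  unoccupied⇒¬caught r∉C caught = let r≢c , r≡c = All.lookupAny r∉C caught in r≢c r≡c

  escape : ∀ {C : Vec Vertex k} {r} → All (r ≢_) C → ∃ λ r′ → adj G r r′ ≡ true × Safe C r′
  escape {C} {r} r∉C =
    let r′ , r~r′ , unguarded = unblocked (guards G) (adj G r) C (All.map guarding r∉C) (degree> r)
    in r′ , r~r′ , All.map (does≡false⇒¬ (step? G _ r′)) unguarded

  safe-start : (C : Vec Vertex k) → Vertex → ∃ (Safe C)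
  safe-start C v =
    let w , _ , w-free = unblocked (λ c u → does (c ≟ u)) (adj G v) C
                           (All.universal occupies≤b C) (degree> v)
        r , _ , safe = escape (All.map (λ {c} free → does≡false⇒¬ (c ≟ w) free ∘ sym) w-free)
    in r , safe
    where
    occupies≤b : ∀ c → countTrue (n G) (λ u → adj G v u ∧ does (c ≟ u)) ≤ b
    occupies≤b c = ≤-trans (countTrue-≤1 λ u w c=u c=w → trans (sym (at u c=u)) (at w c=w)) 1≤b
      where
      at : ∀ u → adj G v u ∧ does (c ≟ u) ≡ true → c ≡ u
      at u e = does≡true⇒ (c ≟ u) (∧-conicalʳ (adj G v u) _ e)

  robber-survives : ∀ {C : Vec Vertex k} {r} → Safe C r → ¬ CopWin G C r
  robber-survives safe (move C′ moves outcome) with unoccupied-after-move moves safe | outcome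
  ... | r∉C′ | inj₁ caught   = unoccupied⇒¬caught r∉C′ caught
  ... | r∉C′ | inj₂ continue with escape r∉C′
  ...   | r′ , r~r′ , safe′ with continue r′ (inj₂ r~r′)
  ...     | inj₁ caught′ = unoccupied⇒¬caught (safe⇒unoccupied safe′) caught′
  ...     | inj₂ copWin′ = robber-survives safe′ copWin′

  robber-evades : Vertex → ¬ CopsWin G k
  robber-evades v (C₀ , copWin) with safe-start C₀ v
  ... | r₀ , safe with copWin r₀
  ...   | inj₁ caught  = unoccupied⇒¬caught (safe⇒unoccupied safe) caught
  ...   | inj₂ copWin₀ = robber-survives safe copWin₀

theorem3p2 : (G : Graph) → 1 ≤ n G → IsPartialCube G →
    ∀ k → CopsWin G k → ⌈ minDegree G /2⌉ ≤ k
theorem3p2 G n≥1 partialCube k copsWin with minDegree G ≤? k + k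
... | yes δ≤2k = ≤-trans (⌈n/2⌉-mono δ≤2k) (≤-reflexive (sym (n≡⌈n+n/2⌉ k)))
... | no  δ≰2k =
  contradiction copsWin (Evasion.robber-evades G guarding (s≤s z≤n) 2k<degree (fromℕ< n≥1))
  where
  guarding : BoundedGuarding G 2
  guarding = cubeSubgraph⇒boundedGuarding {G} (partialCube⇒cubeSubgraph {G} partialCube)

  2k<degree : ∀ v → k * 2 < degree G v
  2k<degree v = begin-strict
    k * 2        ≡⟨ trans (*-comm k 2) (cong (k +_) (+-identityʳ k)) ⟩
    k + k        <⟨ ≰⇒> δ≰2k ⟩
    minDegree G  ≤⟨ minOver-≤ (n G) (degree G) v ⟩
    degree G v   ∎
    where open ≤-Reasoning
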